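{- For integers $n\ge 0$ and $k\ge 0$, let $m(n,k)$ denote the number of maximal independent sets of size exactly $k$ in the meta-pentagonal cactus $M(n)$. Then, as formal power series in $x,y$, $$\sum_{n\ge 0}\sum_{k\ge 0} m(n,k)\,x^n y^k \;=\; 1+\frac{ -11x^2y^4+5xy^2+2x^3y^6+2x^3y^5-x^2y^3}{1-4xy^2-xy+3x^2y^3+4x^2y^4-2x^3y^5}.$$
   Context: For $n\ge 1$, the meta-pentagonal cactus $M(n)$ is the graph formed by a chain of $n$ 5-cycles $B_1,\dots,B_n$, where for each $1\le i\le n-1$ the consecutive cycles $B_i$ and $B_{i+1}$ share exactly one vertex, non-consecutive cycles share no vertex, every vertex lies in at most two cycles, and for each $2\le i\le n-1$ the two shared (cut) vertices of $B_i$ are at distance two in $B_i$. $M(0)$ is the empty graph, so $m(0,0)=1$ and $m(0,k)=0$ for $k\ge1$. An independent set is maximal if no further vertex can be added while keeping it independent. -}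

module Defs where

open import Data.Nat using (ℕ; zero; suc; _+_; _*_; _∸_; _≤?_; _≟_)
open import Data.Nat.Properties using () renaming (_≟_ to _≟ℕ_)
open import Data.Integer as ℤ using (ℤ; +_; 0ℤ; 1ℤ; -_)
open import Data.Fin using (Fin; toℕ)
open import Data.Fin.Properties using (all?)
open import Data.Fin.Subset using (Subset; _∈_; _∉_; _∪_; ⁅_⁆; ∣_∣; inside; outside)
open import Data.Fin.Subset.Properties using (_∈?_)
open import Data.List using (List; []; _∷_; _++_; map; concatMap; upTo; length; filter; foldr)
import Data.List.Membership.Propositional as L
open import Data.List.Membership.DecPropositional using ()
import Data.List.Membership.DecPropositional as LD
open import Data.Bool using (if_then_else_; _∧_)
open import Data.Product using (_×_; _,_)
open import Data.Product.Properties using (≡-dec)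
open import Data.Sum using (_⊎_)
open import Data.Vec using ([]; _∷_)
open import Relation.Nullary using (¬_; Dec; yes; no; ¬?)
open import Relation.Nullary.Decidable using (_×-dec_; _⊎-dec_; _→-dec_; does)
open import Relation.Binary.PropositionalEquality using (_≡_)

-- For n ≥ 1 the vertices are 0 .. 4n, where for the
-- i-th cycle (i = 0 .. n-1):
--   c_i = 4i, u_i = 4i+1, v_i = 4i+2, w_i = 4i+3, c_{i+1} = 4i+4,
-- and the cycle is  c_i - u_i - c_{i+1} - v_i - w_i - c_i .
-- Consecutive cycles share exactly the cut vertex c_{i+1}; the two cut
-- vertices c_i, c_{i+1} of each cycle are at distance two in it.

nV : ℕ → ℕ
nV zero    = 0
nV (suc n) = 4 * suc n + 1

cycleEdges : ℕ → List (ℕ × ℕ)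
cycleEdges i =
    (4 * i     , 4 * i + 1)
  ∷ (4 * i + 1 , 4 * i + 4)
  ∷ (4 * i + 4 , 4 * i + 2)
  ∷ (4 * i + 2 , 4 * i + 3)
  ∷ (4 * i + 3 , 4 * i)
  ∷ []

edges : ℕ → List (ℕ × ℕ)
edges n = concatMap cycleEdges (upTo n)

Adj : (n : ℕ) → Fin (nV n) → Fin (nV n) → Set
Adj n a b = ((toℕ a , toℕ b) L.∈ edges n) ⊎ ((toℕ b , toℕ a) L.∈ edges n)

Independent : (n : ℕ) → Subset (nV n) → Set
Independent n S = ∀ a b → a ∈ S → b ∈ S → ¬ Adj n a b

MaximalIndependent : (n : ℕ) → Subset (nV n) → Set
MaximalIndependent n S =
  Independent n S × (∀ v → v ∉ S → ¬ Independent n (S ∪ ⁅ v ⁆))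

private
  _≟p_ : (p q : ℕ × ℕ) → Dec (p ≡ q)
  _≟p_ = ≡-dec _≟ℕ_ _≟ℕ_

  _∈L?_ : (p : ℕ × ℕ) (xs : List (ℕ × ℕ)) → Dec (p L.∈ xs)
  _∈L?_ = LD._∈?_ _≟p_

adj? : (n : ℕ) (a b : Fin (nV n)) → Dec (Adj n a b)
adj? n a b = ((toℕ a , toℕ b) ∈L? edges n) ⊎-dec ((toℕ b , toℕ a) ∈L? edges n)

independent? : (n : ℕ) (S : Subset (nV n)) → Dec (Independent n S)
independent? n S =
  all? λ a → all? λ b → (a ∈? S) →-dec ((b ∈? S) →-dec ¬? (adj? n a b))

maximalIndependent? : (n : ℕ) (S : Subset (nV n)) → Dec (MaximalIndependent n S)
maximalIndependent? n S =
  independent? n S ×-dec all? (λ v → ¬? (v ∈? S) →-dec ¬? (independent? n (S ∪ ⁅ v ⁆)))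

allSubsets : (N : ℕ) → List (Subset N)
allSubsets zero    = [] ∷ []
allSubsets (suc N) = map (inside ∷_) (allSubsets N) ++ map (outside ∷_) (allSubsets N)

m : ℕ → ℕ → ℕ
m n k = length (filter (λ S → maximalIndependent? n S ×-dec (∣ S ∣ ≟ k)) (allSubsets (nV n)))

-- Formal power series in x, y with integer coefficients:
-- a series is its coefficient function  (n , k) ↦ [x^n y^k].

Series : Set
Series = ℕ → ℕ → ℤ

-- a polynomial is a list of terms  (a , b , c)  meaning  c x^a y^b
Poly : Set
Poly = List (ℕ × ℕ × ℤ)

coeffP : Poly → Series
coeffP []                  n k = 0ℤ
coeffP ((a , b , c) ∷ ps)  n k =
  (if does (a ≟ n) ∧ does (b ≟ k) then c else 0ℤ) ℤ.+ coeffP ps n k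

_·_ : Poly → Series → Series
([]                 · F) n k = 0ℤ
(((a , b , c) ∷ ps) · F) n k =
  (if does (a ≤? n) ∧ does (b ≤? k) then c ℤ.* F (n ∸ a) (k ∸ b) else 0ℤ) ℤ.+ (ps · F) n k

mSeries : Series
mSeries n k = + m n k

minusOne : Series → Series
minusOne F n k = F n k ℤ.- coeffP ((0 , 0 , 1ℤ) ∷ []) n k

numer : Poly
numer = (2 , 4 , - + 11) ∷ (1 , 2 , + 5) ∷ (3 , 6 , + 2) ∷ (3 , 5 , + 2) ∷ (2 , 3 , - + 1) ∷ []

denom : Poly
denom = (0 , 0 , + 1) ∷ (1 , 2 , - + 4) ∷ (1 , 1 , - + 1) ∷ (2 , 3 , + 3) ∷ (2 , 4 , + 4) ∷ (3 , 5 , - + 2) ∷ []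

-- A maximal independent set is an independent dominating set, and both
-- conditions are local.  Scanning M(n) pentagon by pentagon, the rest of the
-- chain only needs to know whether the current cut vertex is in the set and
-- whether it is already dominated.  Writing A n (cut vertex in the set) and
-- B n (out of the set but dominated) for the generating polynomials in y of
-- the admissible configurations of n further pentagons, one gets the transfer
-- recursion A (n+1) = y A n + y B n, B (n+1) = y² A n + 2y² B n, and
-- Σₖ m(n+1,k) yᵏ = y A (n+1) + B (n+1).  By Cayley–Hamilton these polynomials
-- satisfy M (n+2) = (y + 2y²) M (n+1) − y³ M n for n ≥ 1; since the given
-- denominator is (1 − (y + 2y²) x + y³ x²)(1 − 2y² x), the identity follows
-- from this recurrence in x-degree ≥ 4 and is checked by computation in
-- x-degree ≤ 3.
module Submission where

open import Defs
open import Function using (_∘_; _⇔_; mk⇔)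
open import Level using (0ℓ)
open import Data.Nat using (ℕ; zero; suc; _+_; _*_; _∸_; _<_; _≡ᵇ_; _≤?_; s≤s; z≤n)
open import Data.Nat.Properties
  using (+-identityʳ; *-identityˡ; *-distribʳ-+; *-suc; *-comm; +-comm; +-commutativeSemigroup; ≡ᵇ⇒≡; ≡⇒≡ᵇ)
open import Algebra.Properties.CommutativeSemigroup +-commutativeSemigroup using (interchange)
open import Data.Integer as ℤ using (ℤ; 0ℤ; 1ℤ)
import Data.Integer.Properties as ℤ
import Data.Integer.Tactic.RingSolver as ℤ-Solver
open import Data.Bool using (Bool; true; false; _∧_; _∨_; not; T; if_then_else_)
open import Data.Bool.Properties using (∧-zeroʳ; ∧-identityʳ; ∨-identityʳ) renaming (_≟_ to _≟ᵇ_)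
open import Data.Unit using (tt)
open import Data.Product using (_×_; _,_; ∃-syntax)
open import Data.Sum using (_⊎_; inj₁; inj₂; swap; [_,_])
open import Data.Empty using (⊥)
open import Data.List using (List; []; _∷_; _++_; map; concatMap; applyUpTo; length; filter)
open import Data.List.Properties using (map-++)
open import Data.List.Relation.Unary.Any using (here; there)
open import Data.List.Membership.Propositional using () renaming (_∈_ to _∈ˡ_; _∉_ to _∉ˡ_)
open import Data.List.Membership.Propositional.Properties using (∈-++⁻; ∈-map⁻)
open import Data.Vec using ([]; _∷_; here; there)
open import Data.Fin using (zero; suc; toℕ; fromℕ<)
open import Data.Fin.Properties using (toℕ-injective; toℕ-fromℕ<; toℕ<n)
open import Data.Fin.Subset using (Subset; _∈_; _∉_; _∪_; ⁅_⁆; ∣_∣; inside; outside)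
open import Data.Fin.Subset.Properties using (x∈p∪q⁺; x∈p∪q⁻; x∈⁅x⁆; x∈⁅y⁆⇒x≡y)
open import Relation.Nullary using (¬_; does)
open import Relation.Nullary.Decidable using (⌊_⌋; toWitness; does-⇔; T?)
open import Relation.Unary using (Pred; Decidable)
open import Relation.Binary.Definitions using (DecidableEquality)
open import Relation.Binary.PropositionalEquality
  using (_≡_; _≗_; refl; sym; trans; cong; cong₂; subst)

ℕ[y] : Set
ℕ[y] = ℕ → ℕ

𝟘 𝟙 : ℕ[y]
𝟘 _ = 0
𝟙 zero    = 1
𝟙 (suc _) = 0

infixr 6 _⊕_
infix  7 y*_ y^_*_

_⊕_ : ℕ[y] → ℕ[y] → ℕ[y]
(f ⊕ g) k = f k + g k

y*_ : ℕ[y] → ℕ[y]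
(y* f) zero    = 0
(y* f) (suc k) = f k

y^_*_ : ℕ → ℕ[y] → ℕ[y]
y^ zero  * f = f
y^ suc j * f = y* (y^ j * f)

bitSum : (Bool → ℕ[y]) → ℕ[y]
bitSum g = y* g true ⊕ g false

bitSum⁴ : (Bool → Bool → Bool → Bool → ℕ[y]) → ℕ[y]
bitSum⁴ g = bitSum λ a → bitSum λ b → bitSum λ c → bitSum λ d → g a b c d

y*-cong : ∀ {f g} → f ≗ g → y* f ≗ y* g
y*-cong f≗g zero    = refl
y*-cong f≗g (suc k) = f≗g k

y*-⊕ : ∀ f g → y* (f ⊕ g) ≗ y* f ⊕ y* g
y*-⊕ f g zero    = refl
y*-⊕ f g (suc k) = refl

y*-𝟘 : y* 𝟘 ≗ 𝟘
y*-𝟘 zero    = refl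
y*-𝟘 (suc k) = refl

y^-cong : ∀ j {f g} → f ≗ g → y^ j * f ≗ y^ j * g
y^-cong zero    f≗g = f≗g
y^-cong (suc j) f≗g = y*-cong (y^-cong j f≗g)

y^-⊕ : ∀ j f g → y^ j * (f ⊕ g) ≗ y^ j * f ⊕ y^ j * g
y^-⊕ zero    f g k = refl
y^-⊕ (suc j) f g k = trans (y*-cong (y^-⊕ j f g) k) (y*-⊕ (y^ j * f) (y^ j * g) k)

bitSum-cong : ∀ {g h : Bool → ℕ[y]} → (∀ b → g b ≗ h b) → bitSum g ≗ bitSum h
bitSum-cong g≗h k = cong₂ _+_ (y*-cong (g≗h true) k) (g≗h false k)

bitSum⁴-cong : ∀ {g h : Bool → Bool → Bool → Bool → ℕ[y]} →
               (∀ a b c d → g a b c d ≗ h a b c d) → bitSum⁴ g ≗ bitSum⁴ h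
bitSum⁴-cong g≗h =
  bitSum-cong λ a → bitSum-cong λ b → bitSum-cong λ c → bitSum-cong λ d → g≗h a b c d

module LinearCombination where

  infixr 6 _⊕ₑ_
  data Expr : Set where
    atom  : ℕ → Expr
    𝟘ₑ    : Expr
    _⊕ₑ_  : Expr → Expr → Expr
    y*ₑ_  : Expr → Expr

  ⟦_⟧ : Expr → (ℕ → ℕ[y]) → ℕ[y]
  ⟦ atom i ⟧  ρ = ρ i
  ⟦ 𝟘ₑ ⟧      ρ = 𝟘
  ⟦ e ⊕ₑ e′ ⟧ ρ = ⟦ e ⟧ ρ ⊕ ⟦ e′ ⟧ ρ
  ⟦ y*ₑ e ⟧   ρ = y* ⟦ e ⟧ ρ

  Coeffs : Set
  Coeffs = List ℕ

  NF : Set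
  NF = List Coeffs

  _+ᶜ_ : Coeffs → Coeffs → Coeffs
  []       +ᶜ ds       = ds
  (c ∷ cs) +ᶜ []       = c ∷ cs
  (c ∷ cs) +ᶜ (d ∷ ds) = c + d ∷ cs +ᶜ ds

  y*ᶜ : Coeffs → Coeffs
  y*ᶜ []       = []
  y*ᶜ (c ∷ cs) = 0 ∷ c ∷ cs

  _+ⁿ_ : NF → NF → NF
  []       +ⁿ qs       = qs
  (p ∷ ps) +ⁿ []       = p ∷ ps
  (p ∷ ps) +ⁿ (q ∷ qs) = p +ᶜ q ∷ ps +ⁿ qs

  atomⁿ : ℕ → NF
  atomⁿ zero    = (1 ∷ []) ∷ []
  atomⁿ (suc i) = [] ∷ atomⁿ i

  normalise : Expr → NF
  normalise (atom i)  = atomⁿ i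
  normalise 𝟘ₑ        = []
  normalise (e ⊕ₑ e′) = normalise e +ⁿ normalise e′
  normalise (y*ₑ e)   = map y*ᶜ (normalise e)

  ⟦_⟧ᶜ : Coeffs → ℕ[y] → ℕ[y]
  ⟦ []     ⟧ᶜ f k = 0
  ⟦ c ∷ cs ⟧ᶜ f k = c * f k + (y* ⟦ cs ⟧ᶜ f) k

  ⟦_⟧ⁿ : NF → (ℕ → ℕ[y]) → ℕ[y]
  ⟦ []     ⟧ⁿ ρ k = 0
  ⟦ p ∷ ps ⟧ⁿ ρ k = ⟦ p ⟧ᶜ (ρ 0) k + ⟦ ps ⟧ⁿ (λ i → ρ (suc i)) k

  +ᶜ-sound : ∀ cs ds f → ⟦ cs +ᶜ ds ⟧ᶜ f ≗ ⟦ cs ⟧ᶜ f ⊕ ⟦ ds ⟧ᶜ f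
  +ᶜ-sound []       ds       f k = refl
  +ᶜ-sound (c ∷ cs) []       f k = sym (+-identityʳ _)
  +ᶜ-sound (c ∷ cs) (d ∷ ds) f k =
    trans (cong₂ _+_ (*-distribʳ-+ (f k) c d)
                     (trans (y*-cong (+ᶜ-sound cs ds f) k) (y*-⊕ _ _ k)))
          (interchange (c * f k) (d * f k) _ _)

  +ⁿ-sound : ∀ ps qs ρ → ⟦ ps +ⁿ qs ⟧ⁿ ρ ≗ ⟦ ps ⟧ⁿ ρ ⊕ ⟦ qs ⟧ⁿ ρ
  +ⁿ-sound []       qs       ρ k = refl
  +ⁿ-sound (p ∷ ps) []       ρ k = sym (+-identityʳ _)
  +ⁿ-sound (p ∷ ps) (q ∷ qs) ρ k =
    trans (cong₂ _+_ (+ᶜ-sound p q (ρ 0) k) (+ⁿ-sound ps qs (λ i → ρ (suc i)) k))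
          (interchange (⟦ p ⟧ᶜ (ρ 0) k) (⟦ q ⟧ᶜ (ρ 0) k) _ _)

  y*ᶜ-sound : ∀ cs f → ⟦ y*ᶜ cs ⟧ᶜ f ≗ y* ⟦ cs ⟧ᶜ f
  y*ᶜ-sound []       f k = sym (y*-𝟘 k)
  y*ᶜ-sound (c ∷ cs) f k = refl

  y*ⁿ-sound : ∀ ps ρ → ⟦ map y*ᶜ ps ⟧ⁿ ρ ≗ y* ⟦ ps ⟧ⁿ ρ
  y*ⁿ-sound []       ρ k = sym (y*-𝟘 k)
  y*ⁿ-sound (p ∷ ps) ρ k =
    trans (cong₂ _+_ (y*ᶜ-sound p (ρ 0) k) (y*ⁿ-sound ps (λ i → ρ (suc i)) k))
          (sym (y*-⊕ _ _ k))

  atomⁿ-sound : ∀ i ρ → ⟦ atomⁿ i ⟧ⁿ ρ ≗ ρ i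
  atomⁿ-sound zero    ρ k =
    trans (+-identityʳ _)
          (trans (cong (λ z → 1 * ρ 0 k + z) (y*-𝟘 k)) (trans (+-identityʳ _) (*-identityˡ _)))
  atomⁿ-sound (suc i) ρ k = atomⁿ-sound i (λ j → ρ (suc j)) k

  normalise-sound : ∀ e ρ → ⟦ e ⟧ ρ ≗ ⟦ normalise e ⟧ⁿ ρ
  normalise-sound (atom i)  ρ k = sym (atomⁿ-sound i ρ k)
  normalise-sound 𝟘ₑ        ρ k = refl
  normalise-sound (e ⊕ₑ e′) ρ k =
    trans (cong₂ _+_ (normalise-sound e ρ k) (normalise-sound e′ ρ k))
          (sym (+ⁿ-sound (normalise e) (normalise e′) ρ k))
  normalise-sound (y*ₑ e)   ρ k =
    trans (y*-cong (normalise-sound e ρ) k) (sym (y*ⁿ-sound (normalise e) ρ k))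

  solve : ∀ e e′ → normalise e ≡ normalise e′ → ∀ ρ → ⟦ e ⟧ ρ ≗ ⟦ e′ ⟧ ρ
  solve e e′ eq ρ k =
    trans (normalise-sound e ρ k)
          (trans (cong (λ n → ⟦ n ⟧ⁿ ρ k) eq) (sym (normalise-sound e′ ρ k)))

  bitSumₑ : (Bool → Expr) → Expr
  bitSumₑ g = y*ₑ g true ⊕ₑ g false

  bitSum⁴ₑ : (Bool → Bool → Bool → Bool → Expr) → Expr
  bitSum⁴ₑ g = bitSumₑ λ a → bitSumₑ λ b → bitSumₑ λ c → bitSumₑ λ d → g a b c d

infixr 5 _∷ₛ_
_∷ₛ_ : Bool → (ℕ → Bool) → ℕ → Bool
(b ∷ₛ s) zero    = b
(b ∷ₛ s) (suc v) = s v

χ : ∀ {N} → Subset N → ℕ → Bool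
χ []      = λ _ → false
χ (b ∷ S) = b ∷ₛ χ S

sizeGF : ℕ → ((ℕ → Bool) → Bool) → ℕ[y]
sizeGF zero    Q = if Q (λ _ → false) then 𝟙 else 𝟘
sizeGF (suc N) Q = bitSum λ b → sizeGF N (Q ∘ (b ∷ₛ_))

sizeGF-false : ∀ N → sizeGF N (λ _ → false) ≗ 𝟘
sizeGF-false zero    k = refl
sizeGF-false (suc N) k =
  cong₂ _+_ (trans (y*-cong (sizeGF-false N) k) (y*-𝟘 k)) (sizeGF-false N k)

sizeGF-∧ : ∀ N b Q → sizeGF N (λ s → b ∧ Q s) ≗ (if b then sizeGF N Q else 𝟘)
sizeGF-∧ N true  Q k = refl
sizeGF-∧ N false Q k = sizeGF-false N k

count : {A : Set} → (A → Bool) → List A → ℕ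
count p []       = 0
count p (x ∷ xs) = if p x then suc (count p xs) else count p xs

module _ {A : Set} where

  length-filter≡count : ∀ {P : Pred A 0ℓ} (P? : Decidable P) xs →
                        length (filter P? xs) ≡ count (does ∘ P?) xs
  length-filter≡count P? []       = refl
  length-filter≡count P? (x ∷ xs) with does (P? x)
  ... | true  = cong suc (length-filter≡count P? xs)
  ... | false = length-filter≡count P? xs

  count-++ : ∀ p (xs ys : List A) → count p (xs ++ ys) ≡ count p xs + count p ys
  count-++ p []       ys = refl
  count-++ p (x ∷ xs) ys with p x
  ... | true  = cong suc (count-++ p xs ys)
  ... | false = count-++ p xs ys

  count-map : ∀ {B : Set} p (f : B → A) xs → count p (map f xs) ≡ count (p ∘ f) xs
  count-map p f []       = refl
  count-map p f (x ∷ xs) with p (f x)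
  ... | true  = cong suc (count-map p f xs)
  ... | false = count-map p f xs

  count-cong : ∀ {p q : A → Bool} → p ≗ q → count p ≗ count q
  count-cong p≗q []       = refl
  count-cong p≗q (x ∷ xs) rewrite p≗q x | count-cong p≗q xs = refl

  count-false : ∀ xs → count (λ (_ : A) → false) xs ≡ 0
  count-false []       = refl
  count-false (x ∷ xs) = count-false xs

count-allSubsets : ∀ N Q k →
  count (λ S → Q (χ S) ∧ (∣ S ∣ ≡ᵇ k)) (allSubsets N) ≡ sizeGF N Q k
count-allSubsets zero Q k with Q (λ _ → false)
count-allSubsets zero Q zero    | true = refl
count-allSubsets zero Q (suc k) | true = refl
... | false = refl
count-allSubsets (suc N) Q k =
  trans (count-++ _ (map (inside ∷_) (allSubsets N)) (map (outside ∷_) (allSubsets N)))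
        (cong₂ _+_ (trans (count-map _ (inside ∷_) (allSubsets N)) (inside-part k))
                   (trans (count-map _ (outside ∷_) (allSubsets N))
                          (count-allSubsets N (Q ∘ (false ∷ₛ_)) k)))
  where
    inside-part : ∀ k → count (λ S → Q (true ∷ₛ χ S) ∧ (suc ∣ S ∣ ≡ᵇ k)) (allSubsets N)
                      ≡ (y* sizeGF N (Q ∘ (true ∷ₛ_))) k
    inside-part zero    = trans (count-cong (λ S → ∧-zeroʳ (Q (true ∷ₛ χ S))) (allSubsets N))
                                (count-false (allSubsets N))
    inside-part (suc k) = count-allSubsets N (Q ∘ (true ∷ₛ_)) k

∧-T : ∀ {x y} → T x → T y → T (x ∧ y)
∧-T {true} _ ty = ty

∧-T₁ : ∀ x {y} → T (x ∧ y) → T x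
∧-T₁ true _ = tt

∧-T₂ : ∀ x {y} → T (x ∧ y) → T y
∧-T₂ true t = t

∨-T₁ : ∀ {x} y → T x → T (x ∨ y)
∨-T₁ {true} _ _ = tt

∨-T₂ : ∀ x {y} → T y → T (x ∨ y)
∨-T₂ true  _  = tt
∨-T₂ false ty = ty

∨-T⁻ : ∀ x {y} → T (x ∨ y) → T x ⊎ T y
∨-T⁻ true  t = inj₁ t
∨-T⁻ false t = inj₂ t

allBelow : ℕ → (ℕ → Bool) → Bool
allBelow zero    p = true
allBelow (suc N) p = p 0 ∧ allBelow N (p ∘ suc)

allBelow-sound : ∀ N p → T (allBelow N p) → ∀ v → v < N → T (p v)
allBelow-sound (suc N) p t zero    _         = ∧-T₁ (p 0) t
allBelow-sound (suc N) p t (suc v) (s≤s v<N) = allBelow-sound N (p ∘ suc) (∧-T₂ (p 0) t) v v<N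

allBelow-complete : ∀ N p → (∀ v → v < N → T (p v)) → T (allBelow N p)
allBelow-complete zero    p ok = tt
allBelow-complete (suc N) p ok =
  ∧-T (ok 0 (s≤s z≤n)) (allBelow-complete N (p ∘ suc) (λ v v<N → ok (suc v) (s≤s v<N)))

allBelow-cong : ∀ N {p q} → p ≗ q → allBelow N p ≡ allBelow N q
allBelow-cong zero    p≗q = refl
allBelow-cong (suc N) p≗q = cong₂ _∧_ (p≗q 0) (allBelow-cong N (p≗q ∘ suc))

≗-by-table : ∀ {A : Set} (_≟_ : DecidableEquality A) N (f g : ℕ → A) →
             (∀ k → f (N + k) ≡ g (N + k)) → T (allBelow N (λ k → ⌊ f k ≟ g k ⌋)) → f ≗ g
≗-by-table _≟_ zero    f g tail _ k       = tail k
≗-by-table _≟_ (suc N) f g tail t zero    = toWitness {a? = f 0 ≟ g 0} (∧-T₁ ⌊ f 0 ≟ g 0 ⌋ t)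
≗-by-table _≟_ (suc N) f g tail t (suc k) =
  ≗-by-table _≟_ N (f ∘ suc) (g ∘ suc) tail (∧-T₂ ⌊ f 0 ≟ g 0 ⌋ t) k

BoolFun : ℕ → Set
BoolFun zero    = Bool
BoolFun (suc n) = Bool → BoolFun n

Pointwise≡ : ∀ n → BoolFun n → BoolFun n → Set
Pointwise≡ zero    f g = f ≡ g
Pointwise≡ (suc n) f g = ∀ b → Pointwise≡ n (f b) (g b)

truthTable≡ : ∀ n → BoolFun n → BoolFun n → Bool
truthTable≡ zero    f g = ⌊ f ≟ᵇ g ⌋
truthTable≡ (suc n) f g = truthTable≡ n (f true) (g true) ∧ truthTable≡ n (f false) (g false)

truthTable≡-sound : ∀ n f g → T (truthTable≡ n f g) → Pointwise≡ n f g
truthTable≡-sound zero    f g t       = toWitness t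
truthTable≡-sound (suc n) f g t true  = truthTable≡-sound n (f true) (g true) (∧-T₁ _ t)
truthTable≡-sound (suc n) f g t false = truthTable≡-sound n (f false) (g false) (∧-T₂ _ t)

-- Maximal independent sets are independent dominating sets

Edges : Set
Edges = List (ℕ × ℕ)

Edge : Edges → ℕ → ℕ → Set
Edge E a b = (a , b) ∈ˡ E ⊎ (b , a) ∈ˡ E

Loopless : Edges → Set
Loopless E = ∀ {v} → (v , v) ∉ˡ E

-- For E = edges n these are Defs.Independent n and Defs.MaximalIndependent n.
IndependentIn : Edges → ∀ {N} → Subset N → Set
IndependentIn E S = ∀ a b → a ∈ S → b ∈ S → ¬ Edge E (toℕ a) (toℕ b)

MaximalIndependentIn : Edges → ∀ {N} → Subset N → Set
MaximalIndependentIn E S =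
  IndependentIn E S × (∀ v → v ∉ S → ¬ IndependentIn E (S ∪ ⁅ v ⁆))

χ-∈ : ∀ {N} (S : Subset N) {a} → a ∈ S → T (χ S (toℕ a))
χ-∈ (_ ∷ S) here        = tt
χ-∈ (_ ∷ S) (there a∈S) = χ-∈ S a∈S

χ-true : ∀ {N} (S : Subset N) v → T (χ S v) → ∃[ a ] toℕ a ≡ v × a ∈ S
χ-true (true ∷ S) zero    t = zero , refl , here
χ-true (b ∷ S)    (suc v) t with χ-true S v t
... | a , refl , a∈S = suc a , refl , there a∈S

χ-∉ : ∀ {N} (S : Subset N) {a} → a ∉ S → ¬ T (χ S (toℕ a))
χ-∉ S {a} a∉S t with χ-true S (toℕ a) t
... | b , eq , b∈S = a∉S (subst (_∈ S) (toℕ-injective eq) b∈S)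

independentᵇ : Edges → (ℕ → Bool) → Bool
independentᵇ []            s = true
independentᵇ ((a , b) ∷ E) s = not (s a ∧ s b) ∧ independentᵇ E s

hasNeighbourᵇ : Edges → (ℕ → Bool) → ℕ → Bool
hasNeighbourᵇ []            s v = false
hasNeighbourᵇ ((a , b) ∷ E) s v =
  ((a ≡ᵇ v) ∧ s b ∨ (b ≡ᵇ v) ∧ s a) ∨ hasNeighbourᵇ E s v

dominatingᵇ : Edges → ℕ → (ℕ → Bool) → Bool
dominatingᵇ E N s = allBelow N (λ v → s v ∨ hasNeighbourᵇ E s v)

independentᵇ-sound : ∀ E s {a b} → T (independentᵇ E s) → (a , b) ∈ˡ E →
                     T (s a) → T (s b) → ⊥
independentᵇ-sound ((x , y) ∷ E) s ind (here refl) sx sy with s x | s y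
... | true  | true  = ind
... | false | _     = sx
... | true  | false = sy
independentᵇ-sound ((x , y) ∷ E) s ind (there e) sa sb =
  independentᵇ-sound E s (∧-T₂ (not (s x ∧ s y)) ind) e sa sb

independentᵇ-complete : ∀ E s → (∀ {a b} → (a , b) ∈ˡ E → T (s a) → T (s b) → ⊥) →
                        T (independentᵇ E s)
independentᵇ-complete []            s ok = tt
independentᵇ-complete ((x , y) ∷ E) s ok with s x in sx | s y in sy
... | false | _     = independentᵇ-complete E s (ok ∘ there)
... | true  | false = independentᵇ-complete E s (ok ∘ there)
... | true  | true  = ok (here refl) (subst T (sym sx) tt) (subst T (sym sy) tt)

hasNeighbourᵇ-sound : ∀ E s v → T (hasNeighbourᵇ E s v) → ∃[ w ] Edge E v w × T (s w)
hasNeighbourᵇ-sound ((a , b) ∷ E) s v t with ∨-T⁻ ((a ≡ᵇ v) ∧ s b ∨ (b ≡ᵇ v) ∧ s a) t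
... | inj₂ t′ with hasNeighbourᵇ-sound E s v t′
...   | w , inj₁ e , sw = w , inj₁ (there e) , sw
...   | w , inj₂ e , sw = w , inj₂ (there e) , sw
hasNeighbourᵇ-sound ((a , b) ∷ E) s v t | inj₁ t′ with ∨-T⁻ ((a ≡ᵇ v) ∧ s b) t′
... | inj₁ t″ with ≡ᵇ⇒≡ a v (∧-T₁ (a ≡ᵇ v) t″)
...   | refl = b , inj₁ (here refl) , ∧-T₂ (a ≡ᵇ a) t″
hasNeighbourᵇ-sound ((a , b) ∷ E) s v t | inj₁ t′ | inj₂ t″ with ≡ᵇ⇒≡ b v (∧-T₁ (b ≡ᵇ v) t″)
... | refl = a , inj₂ (here refl) , ∧-T₂ (b ≡ᵇ b) t″

hasNeighbourᵇ-complete : ∀ E s {v w} → Edge E v w → T (s w) → T (hasNeighbourᵇ E s v)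
hasNeighbourᵇ-complete ((a , b) ∷ E) s {v} {w} (inj₁ (here refl)) sw =
  ∨-T₁ (hasNeighbourᵇ E s v) (∨-T₁ ((w ≡ᵇ v) ∧ s v) (∧-T (≡⇒≡ᵇ v v refl) sw))
hasNeighbourᵇ-complete ((a , b) ∷ E) s {v} {w} (inj₂ (here refl)) sw =
  ∨-T₁ (hasNeighbourᵇ E s v) (∨-T₂ ((w ≡ᵇ v) ∧ s v) (∧-T (≡⇒≡ᵇ v v refl) sw))
hasNeighbourᵇ-complete ((a , b) ∷ E) s (inj₁ (there e)) sw =
  ∨-T₂ ((a ≡ᵇ _) ∧ s b ∨ (b ≡ᵇ _) ∧ s a) (hasNeighbourᵇ-complete E s (inj₁ e) sw)
hasNeighbourᵇ-complete ((a , b) ∷ E) s (inj₂ (there e)) sw =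
  ∨-T₂ ((a ≡ᵇ _) ∧ s b ∨ (b ≡ᵇ _) ∧ s a) (hasNeighbourᵇ-complete E s (inj₂ e) sw)

module _ {E : Edges} (loopless : Loopless E) {N} (S : Subset N) where

  independentᵇ⇒independent : T (independentᵇ E (χ S)) → IndependentIn E S
  independentᵇ⇒independent ind a b a∈S b∈S (inj₁ e) =
    independentᵇ-sound E (χ S) ind e (χ-∈ S a∈S) (χ-∈ S b∈S)
  independentᵇ⇒independent ind a b a∈S b∈S (inj₂ e) =
    independentᵇ-sound E (χ S) ind e (χ-∈ S b∈S) (χ-∈ S a∈S)

  independent⇒independentᵇ : IndependentIn E S → T (independentᵇ E (χ S))
  independent⇒independentᵇ ind = independentᵇ-complete E (χ S) noEdge
    where
      noEdge : ∀ {a b} → (a , b) ∈ˡ E → T (χ S a) → T (χ S b) → ⊥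
      noEdge {a} {b} e sa sb with χ-true S a sa | χ-true S b sb
      ... | x , refl , x∈S | y , refl , y∈S = ind x y x∈S y∈S (inj₁ e)

  ∪-⁅⁆-independent : IndependentIn E S → ∀ x → ¬ T (hasNeighbourᵇ E (χ S) (toℕ x)) →
                     IndependentIn E (S ∪ ⁅ x ⁆)
  ∪-⁅⁆-independent ind x lonely a b a∈ b∈ e with x∈p∪q⁻ S ⁅ x ⁆ a∈ | x∈p∪q⁻ S ⁅ x ⁆ b∈
  ... | inj₁ a∈S | inj₁ b∈S = ind a b a∈S b∈S e
  ... | inj₁ a∈S | inj₂ b∈x with x∈⁅y⁆⇒x≡y x b∈x
  ...   | refl = lonely (hasNeighbourᵇ-complete E (χ S) (swap e) (χ-∈ S a∈S))
  ∪-⁅⁆-independent ind x lonely a b a∈ b∈ e | inj₂ a∈x | inj₁ b∈S with x∈⁅y⁆⇒x≡y x a∈x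
  ... | refl = lonely (hasNeighbourᵇ-complete E (χ S) e (χ-∈ S b∈S))
  ∪-⁅⁆-independent ind x lonely a b a∈ b∈ e | inj₂ a∈x | inj₂ b∈x
    with x∈⁅y⁆⇒x≡y x a∈x | x∈⁅y⁆⇒x≡y x b∈x
  ... | refl | refl = [ loopless , loopless ] e

  maximal⇒dominatingᵇ : MaximalIndependentIn E S → T (dominatingᵇ E N (χ S))
  maximal⇒dominatingᵇ (ind , maximal) = allBelow-complete N _ dominated
    where
      dominated : ∀ v → v < N → T (χ S v ∨ hasNeighbourᵇ E (χ S) v)
      dominated v v<N with χ S v in sv | hasNeighbourᵇ E (χ S) v in nv
      ... | true  | _     = tt
      ... | false | true  = tt
      ... | false | false = maximal x x∉S (∪-⁅⁆-independent ind x lonely)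
        where
          x = fromℕ< v<N
          x∉S : x ∉ S
          x∉S x∈S = subst T sv (subst (T ∘ χ S) (toℕ-fromℕ< v<N) (χ-∈ S x∈S))
          lonely : ¬ T (hasNeighbourᵇ E (χ S) (toℕ x))
          lonely t = subst T nv (subst (T ∘ hasNeighbourᵇ E (χ S)) (toℕ-fromℕ< v<N) t)

  dominatingᵇ⇒maximal : IndependentIn E S → T (dominatingᵇ E N (χ S)) →
                         ∀ v → v ∉ S → ¬ IndependentIn E (S ∪ ⁅ v ⁆)
  dominatingᵇ⇒maximal ind dom v v∉S ind′
    with ∨-T⁻ (χ S (toℕ v)) (allBelow-sound N _ dom (toℕ v) (toℕ<n v))
  ... | inj₁ sv = χ-∉ S v∉S sv
  ... | inj₂ nv with hasNeighbourᵇ-sound E (χ S) (toℕ v) nv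
  ...   | w , e , sw with χ-true S w sw
  ...     | y , refl , y∈S =
    ind′ v y (x∈p∪q⁺ {p = S} (inj₂ (x∈⁅x⁆ v))) (x∈p∪q⁺ {p = S} (inj₁ y∈S)) e

  maximalIndependent⇔independent∧dominating :
    MaximalIndependentIn E S ⇔ T (independentᵇ E (χ S) ∧ dominatingᵇ E N (χ S))
  maximalIndependent⇔independent∧dominating = mk⇔
    (λ mi@(ind , _) → ∧-T (independent⇒independentᵇ ind) (maximal⇒dominatingᵇ mi))
    (λ t → let ind = independentᵇ⇒independent (∧-T₁ _ t)
           in ind , dominatingᵇ⇒maximal ind (∧-T₂ _ t))

-- The cactus, one pentagon at a time

shift₄ : ℕ × ℕ → ℕ × ℕ
shift₄ (a , b) = 4 + a , 4 + b

cycleEdges-suc : ∀ i → cycleEdges (suc i) ≡ map shift₄ (cycleEdges i)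
cycleEdges-suc i =
  cong (λ c → (c , c + 1) ∷ (c + 1 , c + 4) ∷ (c + 4 , c + 2) ∷ (c + 2 , c + 3) ∷ (c + 3 , c) ∷ [])
       (*-suc 4 i)

concatMap-cycleEdges-suc : ∀ n f → concatMap cycleEdges (applyUpTo (suc ∘ f) n)
                                 ≡ map shift₄ (concatMap cycleEdges (applyUpTo f n))
concatMap-cycleEdges-suc zero    f = refl
concatMap-cycleEdges-suc (suc n) f =
  trans (cong₂ _++_ (cycleEdges-suc (f 0)) (concatMap-cycleEdges-suc n (f ∘ suc)))
        (sym (map-++ shift₄ (cycleEdges (f 0)) _))

edges-suc : ∀ n → edges (suc n) ≡ cycleEdges 0 ++ map shift₄ (edges n)
edges-suc n = cong (cycleEdges 0 ++_) (concatMap-cycleEdges-suc n (λ i → i))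

loopless-edges : ∀ n → Loopless (edges n)
loopless-edges (suc n) {v} e with ∈-++⁻ (cycleEdges 0) (subst ((v , v) ∈ˡ_) (edges-suc n) e)
... | inj₁ (here ())
... | inj₁ (there (here ()))
... | inj₁ (there (there (here ())))
... | inj₁ (there (there (there (here ()))))
... | inj₁ (there (there (there (there (here ())))))
... | inj₂ e′ with ∈-map⁻ shift₄ e′
...   | _ , e″ , refl = loopless-edges n e″

independentᵇ-++ : ∀ E F s → independentᵇ (E ++ F) s ≡ independentᵇ E s ∧ independentᵇ F s
independentᵇ-++ []            F s = refl
independentᵇ-++ ((a , b) ∷ E) F s
  rewrite independentᵇ-++ E F s with s a ∧ s b
... | true  = refl
... | false = refl

independentᵇ-shift₄ : ∀ E s → independentᵇ (map shift₄ E) s ≡ independentᵇ E (s ∘ (4 +_))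
independentᵇ-shift₄ []            s = refl
independentᵇ-shift₄ ((a , b) ∷ E) s = cong (not (s (4 + a) ∧ s (4 + b)) ∧_) (independentᵇ-shift₄ E s)

hasNeighbourᵇ-++ : ∀ E F s v → hasNeighbourᵇ (E ++ F) s v ≡ hasNeighbourᵇ E s v ∨ hasNeighbourᵇ F s v
hasNeighbourᵇ-++ []            F s v = refl
hasNeighbourᵇ-++ ((a , b) ∷ E) F s v
  rewrite hasNeighbourᵇ-++ E F s v with (a ≡ᵇ v) ∧ s b ∨ (b ≡ᵇ v) ∧ s a
... | true  = refl
... | false = refl

hasNeighbourᵇ-shift₄ : ∀ E s → hasNeighbourᵇ (map shift₄ E) s
                             ≗ false ∷ₛ false ∷ₛ false ∷ₛ false ∷ₛ hasNeighbourᵇ E (s ∘ (4 +_))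
hasNeighbourᵇ-shift₄ []            s 0 = refl
hasNeighbourᵇ-shift₄ []            s 1 = refl
hasNeighbourᵇ-shift₄ []            s 2 = refl
hasNeighbourᵇ-shift₄ []            s 3 = refl
hasNeighbourᵇ-shift₄ []            s (suc (suc (suc (suc v)))) = refl
hasNeighbourᵇ-shift₄ ((a , b) ∷ E) s 0 = hasNeighbourᵇ-shift₄ E s 0
hasNeighbourᵇ-shift₄ ((a , b) ∷ E) s 1 = hasNeighbourᵇ-shift₄ E s 1
hasNeighbourᵇ-shift₄ ((a , b) ∷ E) s 2 = hasNeighbourᵇ-shift₄ E s 2
hasNeighbourᵇ-shift₄ ((a , b) ∷ E) s 3 = hasNeighbourᵇ-shift₄ E s 3
hasNeighbourᵇ-shift₄ ((a , b) ∷ E) s (suc (suc (suc (suc v)))) =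
  cong (((a ≡ᵇ v) ∧ s (4 + b) ∨ (b ≡ᵇ v) ∧ s (4 + a)) ∨_)
       (hasNeighbourᵇ-shift₄ E s (suc (suc (suc (suc v)))))

-- d: vertex 0 is already dominated from outside E
dominatesᵇ : ℕ → Bool → (ℕ → Bool) → (ℕ → Bool) → Bool
dominatesᵇ M d s nb = (s 0 ∨ nb 0 ∨ d) ∧ allBelow M (λ v → s (suc v) ∨ nb (suc v))

admissibleᵇ : Edges → ℕ → Bool → (ℕ → Bool) → Bool
admissibleᵇ E M d s = independentᵇ E s ∧ dominatesᵇ M d s (hasNeighbourᵇ E s)

dominatesᵇ-cong : ∀ M d s {nb nb′} → nb ≗ nb′ → dominatesᵇ M d s nb ≡ dominatesᵇ M d s nb′
dominatesᵇ-cong M d s nb≗nb′ =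
  cong₂ _∧_ (cong (λ z → s 0 ∨ z ∨ d) (nb≗nb′ 0))
            (allBelow-cong M (λ v → cong (s (suc v) ∨_) (nb≗nb′ (suc v))))

independent∧dominating≡admissible : ∀ E M s →
  independentᵇ E s ∧ dominatingᵇ E (suc M) s ≡ admissibleᵇ E M false s
independent∧dominating≡admissible E M s =
  cong (λ z → independentᵇ E s ∧ (s 0 ∨ z) ∧ allBelow M (λ v → s (suc v) ∨ hasNeighbourᵇ E s (suc v)))
       (sym (∨-identityʳ (hasNeighbourᵇ E s 0)))

-- The pentagon c–u–c′–v–w–c of Defs.cycleEdges: independence, and domination
-- of c (possibly from the left, d), u, v and w.  Whether c′ is dominated is
-- decided by the next pentagon, which learns u ∨ v.
cycleᵇ : Bool → Bool → Bool → Bool → Bool → Bool → Bool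
cycleᵇ d c u v w c′ =
  (c ∨ u ∨ w ∨ d) ∧ (u ∨ c ∨ c′) ∧ (v ∨ c′ ∨ w) ∧ (w ∨ v ∨ c) ∧
  not (c ∧ u) ∧ not (u ∧ c′) ∧ not (c′ ∧ v) ∧ not (v ∧ w) ∧ not (w ∧ c)

chainᵇ : ℕ → Bool → (ℕ → Bool) → Bool
chainᵇ zero    d s = s 0 ∨ d
chainᵇ (suc n) d s = cycleᵇ d (s 0) (s 1) (s 2) (s 3) (s 4) ∧ chainᵇ n (s 1 ∨ s 2) (s ∘ (4 +_))

cycle-step : ∀ d c u v w c′ X Z W →
  let s  = c ∷ₛ u ∷ₛ v ∷ₛ w ∷ₛ c′ ∷ₛ λ _ → false
      nb = hasNeighbourᵇ (cycleEdges 0) s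
  in (independentᵇ (cycleEdges 0) s ∧ X) ∧
     (c ∨ (nb 0 ∨ false) ∨ d) ∧ (u ∨ nb 1 ∨ false) ∧ (v ∨ nb 2 ∨ false) ∧
     (w ∨ nb 3 ∨ false) ∧ (c′ ∨ nb 4 ∨ Z) ∧ W
   ≡ cycleᵇ d c u v w c′ ∧ X ∧ (c′ ∨ Z ∨ u ∨ v) ∧ W
cycle-step = truthTable≡-sound 9 _ _ tt

admissibleᵇ-step : ∀ E M d s →
  admissibleᵇ (cycleEdges 0 ++ map shift₄ E) (4 + M) d s
  ≡ cycleᵇ d (s 0) (s 1) (s 2) (s 3) (s 4) ∧ admissibleᵇ E M (s 1 ∨ s 2) (s ∘ (4 +_))
admissibleᵇ-step E M d s =
  trans (cong₂ _∧_
          (trans (independentᵇ-++ (cycleEdges 0) (map shift₄ E) s)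
                 (cong (independentᵇ (cycleEdges 0) s ∧_) (independentᵇ-shift₄ E s)))
          (dominatesᵇ-cong (4 + M) d s λ v →
             trans (hasNeighbourᵇ-++ (cycleEdges 0) (map shift₄ E) s v)
                   (cong (hasNeighbourᵇ (cycleEdges 0) s v ∨_) (hasNeighbourᵇ-shift₄ E s v))))
        (cycle-step d (s 0) (s 1) (s 2) (s 3) (s 4) (independentᵇ E (s ∘ (4 +_)))
                    (hasNeighbourᵇ E (s ∘ (4 +_)) 0) _)

admissibleᵇ-edges : ∀ n d s → admissibleᵇ (edges n) (n * 4) d s ≡ chainᵇ n d s
admissibleᵇ-edges zero    d s = ∧-identityʳ (s 0 ∨ d)
admissibleᵇ-edges (suc n) d s =
  trans (cong (λ E → admissibleᵇ E (suc n * 4) d s) (edges-suc n))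
        (trans (admissibleᵇ-step (edges n) (n * 4) d s)
               (cong (cycleᵇ d (s 0) (s 1) (s 2) (s 3) (s 4) ∧_)
                     (admissibleᵇ-edges n (s 1 ∨ s 2) (s ∘ (4 +_)))))

nV-suc : ∀ n → nV (suc n) ≡ suc (suc n * 4)
nV-suc n = trans (+-comm (4 * suc n) 1) (cong suc (*-comm 4 (suc n)))

does-maximalIndependent : ∀ n (S : Subset (nV (suc n))) →
  does (maximalIndependent? (suc n) S) ≡ chainᵇ (suc n) false (χ S)
does-maximalIndependent n S =
  trans (does-⇔ (maximalIndependent⇔independent∧dominating (loopless-edges (suc n)) S)
                (maximalIndependent? (suc n) S) (T? _))
  (trans (cong (λ N → independentᵇ (edges (suc n)) (χ S) ∧ dominatingᵇ (edges (suc n)) N (χ S))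
               (nV-suc n))
  (trans (independent∧dominating≡admissible (edges (suc n)) (suc n * 4) (χ S))
         (admissibleᵇ-edges (suc n) false (χ S))))

m-suc : ∀ n k → m (suc n) k ≡ sizeGF (suc (suc n * 4)) (chainᵇ (suc n) false) k
m-suc n k =
  trans (length-filter≡count _ (allSubsets (nV (suc n))))
  (trans (count-cong (λ S → cong (_∧ (∣ S ∣ ≡ᵇ k)) (does-maximalIndependent n S))
                     (allSubsets (nV (suc n))))
  (trans (count-allSubsets (nV (suc n)) (chainᵇ (suc n) false) k)
         (cong (λ N → sizeGF N (chainᵇ (suc n) false) k) (nV-suc n))))

-- The transfer matrix

transferGF : ℕ → Bool → Bool → ℕ[y]
transferGF n d c = sizeGF (n * 4) (chainᵇ n d ∘ (c ∷ₛ_))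

if-then-𝟘-cong : ∀ b {f g} → f ≗ g → (if b then f else 𝟘) ≗ (if b then g else 𝟘)
if-then-𝟘-cong true  f≗g   = f≗g
if-then-𝟘-cong false _   _ = refl

transferGF-suc : ∀ n d c → transferGF (suc n) d c
               ≗ bitSum⁴ λ u v w c′ → if cycleᵇ d c u v w c′ then transferGF n (u ∨ v) c′ else 𝟘
transferGF-suc n d c =
  bitSum⁴-cong λ u v w c′ → sizeGF-∧ (n * 4) (cycleᵇ d c u v w c′) (chainᵇ n (u ∨ v) ∘ (c′ ∷ₛ_))

mutual
  A : ℕ → ℕ[y]
  A zero    = 𝟙
  A (suc n) = y* A n ⊕ y* B n

  B : ℕ → ℕ[y]
  B zero    = 𝟙
  B (suc n) = y* y* A n ⊕ y* y* B n ⊕ y* y* B n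

-- A cut vertex c ∉ S followed by a pentagon c–u–c′–v–w is dominated inside it:
-- u, w ∉ S would force v, c′ ∈ S, which are adjacent.
closedGF : ℕ → Bool → Bool → ℕ[y]
closedGF n       _     true  = A n
closedGF n       true  false = B n
closedGF zero    false false = 𝟘
closedGF (suc n) false false = B (suc n)

module _ where
  open LinearCombination

  atoms : ℕ → ℕ → ℕ[y]
  atoms n 0 = A n
  atoms n 1 = B n
  atoms n _ = closedGF n false false

  closedₑ : Bool → Bool → Expr
  closedₑ _     true  = atom 0
  closedₑ true  false = atom 1
  closedₑ false false = atom 2

  -- ⟦ Aₑ i ⟧ (atoms n) and ⟦ Bₑ i ⟧ (atoms n) are definitionally A (i + n) and B (i + n).
  mutual
    Aₑ : ℕ → Expr
    Aₑ zero    = atom 0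
    Aₑ (suc i) = y*ₑ Aₑ i ⊕ₑ y*ₑ Bₑ i

    Bₑ : ℕ → Expr
    Bₑ zero    = atom 1
    Bₑ (suc i) = y*ₑ y*ₑ Aₑ i ⊕ₑ y*ₑ y*ₑ Bₑ i ⊕ₑ y*ₑ y*ₑ Bₑ i

  leafₑ : Bool → Bool → Bool → Bool → Bool → Bool → Expr
  leafₑ d c u v w c′ = if cycleᵇ d c u v w c′ then closedₑ (u ∨ v) c′ else 𝟘ₑ

  transfer-step : ∀ n d c →
    (bitSum⁴ λ u v w c′ → if cycleᵇ d c u v w c′ then closedGF n (u ∨ v) c′ else 𝟘)
    ≗ closedGF (suc n) d c
  transfer-step n d     true  = solve (bitSum⁴ₑ (leafₑ d true))      (Aₑ 1) refl (atoms n)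
  transfer-step n true  false = solve (bitSum⁴ₑ (leafₑ true false))  (Bₑ 1) refl (atoms n)
  transfer-step n false false = solve (bitSum⁴ₑ (leafₑ false false)) (Bₑ 1) refl (atoms n)

  misₑ : ℕ → Expr
  misₑ i = y*ₑ Aₑ (suc i) ⊕ₑ Bₑ (suc i)

transferGF≗closedGF : ∀ n d c → transferGF n d c ≗ closedGF n d c
transferGF≗closedGF zero    d     true  k = refl
transferGF≗closedGF zero    true  false k = refl
transferGF≗closedGF zero    false false k = refl
transferGF≗closedGF (suc n) d     c     k =
  trans (transferGF-suc n d c k)
        (trans (bitSum⁴-cong (λ u v w c′ → if-then-𝟘-cong (cycleᵇ d c u v w c′)
                                              (transferGF≗closedGF n (u ∨ v) c′)) k)
               (transfer-step n d c k))

mis : ℕ → ℕ[y]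
mis zero    = 𝟙
mis (suc n) = y* A (suc n) ⊕ B (suc n)

m≡mis : ∀ n k → m n k ≡ mis n k
m≡mis zero    zero    = refl
m≡mis zero    (suc k) = refl
m≡mis (suc n) k =
  trans (m-suc n k)
        (cong₂ _+_ (y*-cong (transferGF≗closedGF (suc n) false true) k)
                   (transferGF≗closedGF (suc n) false false k))

mis-recurrence : ∀ n → mis (3 + n) ⊕ y^ 3 * mis (1 + n)
                     ≗ y* mis (2 + n) ⊕ y^ 2 * mis (2 + n) ⊕ y^ 2 * mis (2 + n)
mis-recurrence n = solve (misₑ 2 ⊕ₑ y*ₑ y*ₑ y*ₑ misₑ 0)
                         (y*ₑ misₑ 1 ⊕ₑ y*ₑ y*ₑ misₑ 1 ⊕ₑ y*ₑ y*ₑ misₑ 1) refl (atoms n)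
  where open LinearCombination

y²-mis-recurrence : ∀ n k →
  (y^ 2 * mis (3 + n)) k + (y^ 5 * mis (1 + n)) k
  ≡ (y^ 3 * mis (2 + n)) k + ((y^ 4 * mis (2 + n)) k + (y^ 4 * mis (2 + n)) k)
y²-mis-recurrence n k =
  trans (sym (y^-⊕ 2 (mis (3 + n)) (y^ 3 * mis (1 + n)) k))
  (trans (y^-cong 2 (mis-recurrence n) k)
  (trans (y^-⊕ 2 (y* mis (2 + n)) _ k)
         (cong ((y^ 3 * mis (2 + n)) k +_) (y^-⊕ 2 (y^ 2 * mis (2 + n)) _ k))))

misSeries : Series
misSeries n k = ℤ.+ mis n k

·-cong : ∀ p {F G : Series} → (∀ a b → F a b ≡ G a b) → ∀ n k → (p · F) n k ≡ (p · G) n k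
·-cong []                 F≡G n k = refl
·-cong ((a , b , c) ∷ ps) F≡G n k =
  cong₂ ℤ._+_ (cong (λ z → if does (a ≤? n) ∧ does (b ≤? k) then c ℤ.* z else 0ℤ)
                    (F≡G (n ∸ a) (k ∸ b)))
              (·-cong ps F≡G n k)

-- One term c xᵃ yᵇ of denom, at an x-degree beyond a; the + 0 is what is
-- left of the constant term subtracted by minusOne.
term-coeff : ∀ b k (c : ℤ) (f : ℕ[y]) →
  (if does (b ≤? k) then c ℤ.* ℤ.+ (f (k ∸ b) + 0) else 0ℤ) ≡ c ℤ.* ℤ.+ (y^ b * f) k
term-coeff zero          k       c f = cong (λ z → c ℤ.* ℤ.+ z) (+-identityʳ (f k))
term-coeff (suc b)       zero    c f = sym (ℤ.*-zeroʳ c)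
term-coeff (suc zero)    (suc k) c f = cong (λ z → c ℤ.* ℤ.+ z) (+-identityʳ (f k))
term-coeff (suc (suc b)) (suc k) c f = term-coeff (suc b) k c f

-- The two differences on the right are the recurrence at n + 1 and y² times
-- the recurrence at n.
denom-regroup : ∀ P Q₁ Q₂ R₃ R₄ S₅ →
  ℤ.+ 1 ℤ.* P ℤ.+ (ℤ.- ℤ.+ 4 ℤ.* Q₂ ℤ.+ (ℤ.- ℤ.+ 1 ℤ.* Q₁ ℤ.+ (ℤ.+ 3 ℤ.* R₃ ℤ.+
    (ℤ.+ 4 ℤ.* R₄ ℤ.+ (ℤ.- ℤ.+ 2 ℤ.* S₅ ℤ.+ 0ℤ)))))
  ≡ (P ℤ.+ R₃ ℤ.- (Q₁ ℤ.+ (Q₂ ℤ.+ Q₂))) ℤ.- ℤ.+ 2 ℤ.* (Q₂ ℤ.+ S₅ ℤ.- (R₃ ℤ.+ (R₄ ℤ.+ R₄)))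
denom-regroup = ℤ-Solver.solve-∀

m≡n⇒+m-+n≡0 : ∀ {a b} → a ≡ b → ℤ.+ a ℤ.- ℤ.+ b ≡ 0ℤ
m≡n⇒+m-+n≡0 {a} refl = ℤ.+-inverseʳ (ℤ.+ a)

denom-annihilates : ∀ n k → (denom · minusOne misSeries) (4 + n) k ≡ coeffP numer (4 + n) k
denom-annihilates n k =
  trans (cong₂ ℤ._+_ (term-coeff 0 k (ℤ.+ 1) (mis (4 + n)))
        (cong₂ ℤ._+_ (term-coeff 2 k (ℤ.- ℤ.+ 4) (mis (3 + n)))
        (cong₂ ℤ._+_ (term-coeff 1 k (ℤ.- ℤ.+ 1) (mis (3 + n)))
        (cong₂ ℤ._+_ (term-coeff 3 k (ℤ.+ 3) (mis (2 + n)))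
        (cong₂ ℤ._+_ (term-coeff 4 k (ℤ.+ 4) (mis (2 + n)))
        (cong₂ ℤ._+_ (term-coeff 5 k (ℤ.- ℤ.+ 2) (mis (1 + n))) refl))))))
  (trans (denom-regroup (ℤ.+ mis (4 + n) k) (ℤ.+ (y* mis (3 + n)) k) (ℤ.+ (y^ 2 * mis (3 + n)) k)
                        (ℤ.+ (y^ 3 * mis (2 + n)) k) (ℤ.+ (y^ 4 * mis (2 + n)) k)
                        (ℤ.+ (y^ 5 * mis (1 + n)) k))
         (cong₂ (λ a b → a ℤ.- ℤ.+ 2 ℤ.* b)
                (m≡n⇒+m-+n≡0 (mis-recurrence (suc n) k))
                (m≡n⇒+m-+n≡0 (y²-mis-recurrence n k))))

-- In x-degree ≤ 3 all y-degrees are below 10; beyond that both sides compute to 0.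
denom·misSeries : ∀ n k → (denom · minusOne misSeries) n k ≡ coeffP numer n k
denom·misSeries 0 = ≗-by-table ℤ._≟_ 10 ((denom · minusOne misSeries) 0) (coeffP numer 0) (λ _ → refl) tt
denom·misSeries 1 = ≗-by-table ℤ._≟_ 10 ((denom · minusOne misSeries) 1) (coeffP numer 1) (λ _ → refl) tt
denom·misSeries 2 = ≗-by-table ℤ._≟_ 10 ((denom · minusOne misSeries) 2) (coeffP numer 2) (λ _ → refl) tt
denom·misSeries 3 = ≗-by-table ℤ._≟_ 10 ((denom · minusOne misSeries) 3) (coeffP numer 3) (λ _ → refl) tt
denom·misSeries (suc (suc (suc (suc n)))) k = denom-annihilates n k

theorem2p12 : (n k : ℕ) → (denom · minusOne mSeries) n k ≡ coeffP numer n k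
theorem2p12 n k =
  trans (·-cong denom (λ a b → cong (λ x → ℤ.+ x ℤ.- coeffP ((0 , 0 , 1ℤ) ∷ []) a b) (m≡mis a b)) n k)
        (denom·misSeries n k)
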